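{- Let $I$ be a fuzzy implication satisfying the ordering property ($I(x,y)=1\iff x\le y$ for all $x,y\in[0,1]$), and let $A$ be a commutative binary aggregation function. If $I(A(x,y),z)=I(x,I(y,z))$ for all $x,y,z\in[0,1]$, then $A(a,I(a,b))\le b$ for all $a,b\in[0,1]$.
   Context: A binary aggregation function is a map $A:[0,1]^2\to[0,1]$, non-decreasing in each variable, with $A(0,0)=0$, $A(1,1)=1$; it is commutative if $A(x,y)=A(y,x)$. A fuzzy implication is a map $I:[0,1]^2\to[0,1]$, non-increasing in the first variable, non-decreasing in the second, with $I(0,0)=I(1,1)=1$, $I(1,0)=0$. -}

module Defs where

open import Level using (Level; _⊔_; suc)
open import Data.Product using (_×_)
open import Relation.Binary.Bundles using (TotalOrder)

-- An abstract stand-in for the unit interval [0,1]: a totally ordered set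
-- (with its equality _≈_ and order _≤_) having a least element 0ᵤ and a
-- greatest element 1ᵤ.
record BoundedChain (c ℓ₁ ℓ₂ : Level) : Set (suc (c ⊔ ℓ₁ ⊔ ℓ₂)) where
  field
    totalOrder : TotalOrder c ℓ₁ ℓ₂
  open TotalOrder totalOrder public
  field
    0ᵤ      : Carrier
    1ᵤ      : Carrier
    0ᵤ-min  : ∀ x → 0ᵤ ≤ x
    1ᵤ-max  : ∀ x → x ≤ 1ᵤ

module _ {c ℓ₁ ℓ₂ : Level} (L : BoundedChain c ℓ₁ ℓ₂) where
  open BoundedChain L

  record IsAggregation (A : Carrier → Carrier → Carrier) : Set (c ⊔ ℓ₁ ⊔ ℓ₂) where
    field
      mono₁ : ∀ {x x′ y} → x ≤ x′ → A x y ≤ A x′ y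
      mono₂ : ∀ {x y y′} → y ≤ y′ → A x y ≤ A x y′
      A00   : A 0ᵤ 0ᵤ ≈ 0ᵤ
      A11   : A 1ᵤ 1ᵤ ≈ 1ᵤ

  IsCommutative : (Carrier → Carrier → Carrier) → Set (c ⊔ ℓ₁)
  IsCommutative A = ∀ x y → A x y ≈ A y x

  record IsFuzzyImplication (I : Carrier → Carrier → Carrier) : Set (c ⊔ ℓ₁ ⊔ ℓ₂) where
    field
      antitone₁ : ∀ {x x′ y} → x ≤ x′ → I x′ y ≤ I x y
      mono₂     : ∀ {x y y′} → y ≤ y′ → I x y ≤ I x y′
      I00       : I 0ᵤ 0ᵤ ≈ 1ᵤ
      I11       : I 1ᵤ 1ᵤ ≈ 1ᵤ
      I10       : I 1ᵤ 0ᵤ ≈ 0ᵤ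

  OrderingProperty : (Carrier → Carrier → Carrier) → Set (c ⊔ ℓ₁ ⊔ ℓ₂)
  OrderingProperty I = ∀ x y → (I x y ≈ 1ᵤ → x ≤ y) × (x ≤ y → I x y ≈ 1ᵤ)

-- The law of importation turns I(A(I(a,b),a),b) into I(I(a,b),I(a,b)), which
-- is 1 by the ordering property; the ordering property read backwards then
-- gives A(I(a,b),a) ≤ b, and commutativity swaps the arguments of A.
module Submission where

open import Defs
open import Level using (Level)
open import Data.Product using (proj₁; proj₂)

module _ {c ℓ₁ ℓ₂ : Level} (L : BoundedChain c ℓ₁ ℓ₂) where
  open BoundedChain L

  module _ (I A : Carrier → Carrier → Carrier) (op : OrderingProperty L I)
           (importation : ∀ x y z → I (A x y) z ≈ I x (I y z)) where

    importation-modusPonens : ∀ a b → A (I a b) a ≤ b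
    importation-modusPonens a b = proj₁ (op (A (I a b) a) b) I[A[Iab,a],b]≈1
      where
      I[A[Iab,a],b]≈1 : I (A (I a b) a) b ≈ 1ᵤ
      I[A[Iab,a],b]≈1 =
        Eq.trans (importation (I a b) a b) (proj₂ (op (I a b) (I a b)) refl)

proposition3p15 : ∀ {c ℓ₁ ℓ₂ : Level} (L : BoundedChain c ℓ₁ ℓ₂) →
    let open BoundedChain L in
    (I A : Carrier → Carrier → Carrier) →
    IsFuzzyImplication L I →
    OrderingProperty L I →
    IsAggregation L A →
    IsCommutative L A →
    (∀ x y z → I (A x y) z ≈ I x (I y z)) →
    ∀ a b → A a (I a b) ≤ b
proposition3p15 L I A _ op _ comm importation a b =
  trans (reflexive (comm a (I a b))) (importation-modusPonens L I A op importation a b)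
  where open BoundedChain L
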